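{- Let $w=w_1w_2\cdots w_n$ be a word of $n$ distinct positive integers avoiding the patterns $3124$ and $3214$. Let $x$ be the index with $w_x=\max(w)$, and let $i_1<i_2<\dots<i_k$ be the indices $i<x$ with $w_i>w_{i+1}$, so that $w_1\cdots w_x$ is the concatenation of the ascending runs $w_1\cdots w_{i_1}$, $w_{i_1+1}\cdots w_{i_2}$, $\dots$, $w_{i_k+1}\cdots w_x$; let $w''=w_{x+1}\cdots w_n$. Then: 1. $\mathrm{Lrmax}(w)=\{w_j: 1\le j\le x,\ j\notin\{i_1+1,i_2+1,\dots,i_k+1\}\}$; 2. $w''$ is a concatenation $w''=b\,b_k\,b_{k-1}\cdots b_1$ of (possibly empty) factors of consecutive entries such that every entry of $b$ is larger than $w_{i_k}$, every entry of $b_j$ is smaller than $w_{i_j}$ and larger than $w_{i_{j-1}}$ for $2\le j\le k$, and every entry of $b_1$ is smaller than $w_{i_1}$.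
   Context: A word $w$ contains a pattern $P=p_1\cdots p_k$ if some subsequence $w_{i_1}\cdots w_{i_k}$ ($i_1<\dots<i_k$) is order-isomorphic to $P$; otherwise it avoids $P$. $\mathrm{Lrmax}(w)$ is the set of entries $w_i$ with $w_i>w_j$ for all $j<i$. A factor is a (contiguous) subword of consecutive positions. -}

module Defs where

open import Data.Nat using (ℕ; zero; suc; _<_; _≤_; _∸_)
open import Data.Fin using (Fin; toℕ)
import Data.Fin as F
open import Data.Vec using (Vec; _∷_; []; lookup)
open import Data.Product using (Σ; ∃; _×_; _,_)
open import Relation.Binary.PropositionalEquality using (_≡_; _≢_)
open import Relation.Nullary using (¬_)
open import Function.Bundles using (_⇔_)

-- A word of length n is a function from positions (0-based, Fin n) to ℕ.
Word : ℕ → Set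
Word n = Fin n → ℕ

Contains : ∀ {k n} → Word k → Word n → Set
Contains {k} {n} P w =
  Σ (Fin k → Fin n) λ f →
    (∀ a b → a F.< b → f a F.< f b) ×
    (∀ a b → (P a < P b) ⇔ (w (f a) < w (f b)))

Avoids : ∀ {k n} → Word k → Word n → Set
Avoids P w = ¬ Contains P w

p3124 : Word 4
p3124 = lookup (3 ∷ 1 ∷ 2 ∷ 4 ∷ [])

p3214 : Word 4
p3214 = lookup (3 ∷ 2 ∷ 1 ∷ 4 ∷ [])

InLrmax : ∀ {n} → Word n → ℕ → Set
InLrmax {n} w v = Σ (Fin n) λ i → (w i ≡ v) × (∀ j → j F.< i → w j < w i)

DescentAt : ∀ {n} → Word n → Fin n → Set
DescentAt {n} w i = Σ (Fin n) λ j → (toℕ j ≡ suc (toℕ i)) × (w j < w i)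

{-# OPTIONS --safe #-}
module Submission where

open import Defs
open import Data.Nat using (ℕ; suc; _<_; _≤_; z≤n; s≤s; _≤′_; ≤′-refl; ≤′-step; _<?_; _≤?_)
open import Data.Nat.Properties
open import Data.Fin using (Fin; toℕ; fromℕ<; inject₁)
import Data.Fin as F
import Data.Fin.Properties as Fin
open import Data.Vec using (_∷_; []; lookup)
open import Data.Product using (Σ; ∃; _×_; _,_; proj₁; proj₂)
open import Data.Sum using (inj₁; inj₂)
open import Data.Empty using (⊥; ⊥-elim)
open import Function using (_∘_; case_of_)
open import Function.Bundles using (_⇔_; mk⇔; Equivalence)
open import Function.Definitions using (Injective)
open import Relation.Binary using (Rel; Transitive; tri<; tri≈; tri>)
open import Relation.Binary.PropositionalEquality
open import Relation.Nullary using (¬_; yes; no)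
open import Relation.Nullary.Decidable using (True; toWitness)
open import Relation.Unary using (Pred; Decidable)

-- Avoiding 3124 and 3214 means exactly: no entry is followed by two smaller
-- entries and then a larger one.  Applied with the maximum as the larger entry,
-- this forces the tops of the descents before the maximum to increase, makes
-- every entry up to the maximum that does not end a descent a left-to-right
-- maximum, and shows that after the maximum, once an entry drops below a
-- descent top, all later entries stay below it.  So for each descent top the
-- positions after the maximum split into an initial segment of larger entries
-- followed by a segment of smaller ones, and these split points nest, giving
-- the factors b, b_k, ..., b_1.

pattern i0 = F.zero
pattern i1 = F.suc F.zero
pattern i2 = F.suc (F.suc F.zero)
pattern i3 = F.suc (F.suc (F.suc F.zero))

absurd-< : ∀ {m k} {k≤m : True (k ≤? m)} → m < k → ⊥
absurd-< {k≤m = k≤m} m<k = <⇒≱ m<k (toWitness k≤m)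

contains-of-order-preserving : ∀ {k n} (P : Word k) (w : Word n) (f : Fin k → Fin n) →
  Injective _≡_ _≡_ P → (∀ a b → a F.< b → f a F.< f b) →
  (∀ a b → P a < P b → w (f a) < w (f b)) → Contains P w
contains-of-order-preserving P w f P-injective f-increasing preserves =
  f , f-increasing , λ a b → mk⇔ (preserves a b) (reflects a b)
  where
  reflects : ∀ a b → w (f a) < w (f b) → P a < P b
  reflects a b lt with <-cmp (P a) (P b)
  ... | tri< Pa<Pb _ _ = Pa<Pb
  ... | tri≈ _ Pa≡Pb _ = ⊥-elim (<-irrefl (cong (w ∘ f) (P-injective Pa≡Pb)) lt)
  ... | tri> _ _ Pb<Pa = ⊥-elim (<-asym lt (preserves b a Pb<Pa))

increasing-of-chain : ∀ {a ℓ} {A : Set a} {_≺_ : Rel A ℓ} → Transitive _≺_ →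
  (u : Fin 4 → A) → u i0 ≺ u i1 → u i1 ≺ u i2 → u i2 ≺ u i3 →
  ∀ r s → r F.< s → u r ≺ u s
increasing-of-chain trans u u01 u12 u23 i0 i1 _ = u01
increasing-of-chain trans u u01 u12 u23 i0 i2 _ = trans u01 u12
increasing-of-chain trans u u01 u12 u23 i0 i3 _ = trans u01 (trans u12 u23)
increasing-of-chain trans u u01 u12 u23 i1 i2 _ = u12
increasing-of-chain trans u u01 u12 u23 i1 i3 _ = trans u12 u23
increasing-of-chain trans u u01 u12 u23 i2 i3 _ = u23
increasing-of-chain trans u u01 u12 u23 i0 i0 lt = ⊥-elim (absurd-< lt)
increasing-of-chain trans u u01 u12 u23 i1 i0 lt = ⊥-elim (absurd-< lt)
increasing-of-chain trans u u01 u12 u23 i1 i1 lt = ⊥-elim (absurd-< lt)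
increasing-of-chain trans u u01 u12 u23 i2 i0 lt = ⊥-elim (absurd-< lt)
increasing-of-chain trans u u01 u12 u23 i2 i1 lt = ⊥-elim (absurd-< lt)
increasing-of-chain trans u u01 u12 u23 i2 i2 lt = ⊥-elim (absurd-< lt)
increasing-of-chain trans u u01 u12 u23 i3 i0 lt = ⊥-elim (absurd-< lt)
increasing-of-chain trans u u01 u12 u23 i3 i1 lt = ⊥-elim (absurd-< lt)
increasing-of-chain trans u u01 u12 u23 i3 i2 lt = ⊥-elim (absurd-< lt)
increasing-of-chain trans u u01 u12 u23 i3 i3 lt = ⊥-elim (absurd-< lt)

contains-at : ∀ {n} (P : Word 4) (w : Word n) → Injective _≡_ _≡_ P →
  ∀ {a b c e} → a F.< b → b F.< c → c F.< e →
  (∀ r s → P r < P s →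
     w (lookup (a ∷ b ∷ c ∷ e ∷ []) r) < w (lookup (a ∷ b ∷ c ∷ e ∷ []) s)) →
  Contains P w
contains-at P w P-injective {a} {b} {c} {e} a<b b<c c<e =
  contains-of-order-preserving P w f P-injective (increasing-of-chain Fin.<-trans f a<b b<c c<e)
  where
  f : Fin 4 → Fin _
  f = lookup (a ∷ b ∷ c ∷ e ∷ [])

p3124-injective : Injective _≡_ _≡_ p3124
p3124-injective {a} {b} eq = trans (sym (position-letter a)) (trans (cong position eq) (position-letter b))
  where
  position : ℕ → Fin 4
  position 3 = i0
  position 1 = i1
  position 2 = i2
  position _ = i3
  position-letter : ∀ r → position (p3124 r) ≡ r
  position-letter i0 = refl
  position-letter i1 = refl
  position-letter i2 = refl
  position-letter i3 = refl

p3214-injective : Injective _≡_ _≡_ p3214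
p3214-injective {a} {b} eq = trans (sym (position-letter a)) (trans (cong position eq) (position-letter b))
  where
  position : ℕ → Fin 4
  position 3 = i0
  position 2 = i1
  position 1 = i2
  position _ = i3
  position-letter : ∀ r → position (p3214 r) ≡ r
  position-letter i0 = refl
  position-letter i1 = refl
  position-letter i2 = refl
  position-letter i3 = refl

p3124-order : (v : Fin 4 → ℕ) → v i1 < v i2 → v i2 < v i0 → v i0 < v i3 →
  ∀ a b → p3124 a < p3124 b → v a < v b
p3124-order v v12 v20 v03 i1 i2 _ = v12
p3124-order v v12 v20 v03 i1 i0 _ = <-trans v12 v20
p3124-order v v12 v20 v03 i1 i3 _ = <-trans v12 (<-trans v20 v03)
p3124-order v v12 v20 v03 i2 i0 _ = v20
p3124-order v v12 v20 v03 i2 i3 _ = <-trans v20 v03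
p3124-order v v12 v20 v03 i0 i3 _ = v03
p3124-order v v12 v20 v03 i0 i0 lt = ⊥-elim (absurd-< lt)
p3124-order v v12 v20 v03 i0 i1 lt = ⊥-elim (absurd-< lt)
p3124-order v v12 v20 v03 i0 i2 lt = ⊥-elim (absurd-< lt)
p3124-order v v12 v20 v03 i1 i1 lt = ⊥-elim (absurd-< lt)
p3124-order v v12 v20 v03 i2 i1 lt = ⊥-elim (absurd-< lt)
p3124-order v v12 v20 v03 i2 i2 lt = ⊥-elim (absurd-< lt)
p3124-order v v12 v20 v03 i3 i0 lt = ⊥-elim (absurd-< lt)
p3124-order v v12 v20 v03 i3 i1 lt = ⊥-elim (absurd-< lt)
p3124-order v v12 v20 v03 i3 i2 lt = ⊥-elim (absurd-< lt)
p3124-order v v12 v20 v03 i3 i3 lt = ⊥-elim (absurd-< lt)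

p3214-order : (v : Fin 4 → ℕ) → v i2 < v i1 → v i1 < v i0 → v i0 < v i3 →
  ∀ a b → p3214 a < p3214 b → v a < v b
p3214-order v v21 v10 v03 i2 i1 _ = v21
p3214-order v v21 v10 v03 i2 i0 _ = <-trans v21 v10
p3214-order v v21 v10 v03 i2 i3 _ = <-trans v21 (<-trans v10 v03)
p3214-order v v21 v10 v03 i1 i0 _ = v10
p3214-order v v21 v10 v03 i1 i3 _ = <-trans v10 v03
p3214-order v v21 v10 v03 i0 i3 _ = v03
p3214-order v v21 v10 v03 i0 i0 lt = ⊥-elim (absurd-< lt)
p3214-order v v21 v10 v03 i0 i1 lt = ⊥-elim (absurd-< lt)
p3214-order v v21 v10 v03 i0 i2 lt = ⊥-elim (absurd-< lt)
p3214-order v v21 v10 v03 i1 i1 lt = ⊥-elim (absurd-< lt)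
p3214-order v v21 v10 v03 i1 i2 lt = ⊥-elim (absurd-< lt)
p3214-order v v21 v10 v03 i2 i2 lt = ⊥-elim (absurd-< lt)
p3214-order v v21 v10 v03 i3 i0 lt = ⊥-elim (absurd-< lt)
p3214-order v v21 v10 v03 i3 i1 lt = ⊥-elim (absurd-< lt)
p3214-order v v21 v10 v03 i3 i2 lt = ⊥-elim (absurd-< lt)
p3214-order v v21 v10 v03 i3 i3 lt = ⊥-elim (absurd-< lt)

predecessor : ∀ {n} (j : Fin n) → 0 < toℕ j → ∃ λ (c : Fin n) → toℕ j ≡ suc (toℕ c)
predecessor (F.suc c) _ = inject₁ c , cong suc (sym (Fin.toℕ-inject₁ c))

LrmaxAt : ∀ {n} → Word n → Fin n → Set
LrmaxAt w i = ∀ j → j F.< i → w j < w i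

lrmax-not-after-descent : ∀ {n} {w : Word n} {i c} →
  LrmaxAt w i → toℕ i ≡ suc (toℕ c) → ¬ DescentAt w c
lrmax-not-after-descent {c = c} i-lrmax i≡1+c (j , j≡1+c , wj<wc)
  with Fin.toℕ-injective (trans j≡1+c (sym i≡1+c))
... | refl = <-asym wj<wc (i-lrmax c (≤-reflexive (sym i≡1+c)))

record Threshold {n ℓ} (P : Pred (Fin n) ℓ) (q : ℕ) : Set ℓ where
  field
    point        : ℕ
    q≤point      : q ≤ point
    point≤n      : point ≤ n
    fails-before : ∀ a → q ≤ toℕ a → toℕ a < point → ¬ P a
    holds-from   : ∀ a → point ≤ toℕ a → P a

module _ {n ℓ} {P : Pred (Fin n) ℓ} (P? : Decidable P) {q : ℕ}
         (P-upward-closed : ∀ {a b} → q ≤ toℕ a → a F.≤ b → P a → P b) where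

  threshold : q ≤ n → Threshold P q
  threshold q≤n =
    let t , q≤t , t≤n , fails , holds = threshold-below (≤⇒≤′ q≤n) ≤-refl
    in record { point = t ; q≤point = q≤t ; point≤n = t≤n ; fails-before = fails
              ; holds-from = λ a t≤a → holds a t≤a (Fin.toℕ<n a) }
    where
    threshold-below : ∀ {u} → q ≤′ u → u ≤ n → ∃ λ t → q ≤ t × t ≤ u ×
      (∀ a → q ≤ toℕ a → toℕ a < t → ¬ P a) × (∀ a → t ≤ toℕ a → toℕ a < u → P a)
    threshold-below ≤′-refl _ =
      q , ≤-refl , ≤-refl , (λ _ q≤a a<q → ⊥-elim (<⇒≱ a<q q≤a)) ,
      (λ _ q≤a a<q → ⊥-elim (<⇒≱ a<q q≤a))
    threshold-below (≤′-step {u} q≤′u) u<n with P? (fromℕ< u<n)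
    ... | yes Pu =
      let t , q≤t , t≤u , fails , holds = threshold-below q≤′u (<⇒≤ u<n)
      in t , q≤t , m≤n⇒m≤1+n t≤u , fails , λ a t≤a a<1+u →
           case m≤n⇒m<n∨m≡n (≤-pred a<1+u) of λ where
             (inj₁ a<u) → holds a t≤a a<u
             (inj₂ a≡u) →
               subst P (Fin.toℕ-injective (trans (Fin.toℕ-fromℕ< u<n) (sym a≡u))) Pu
    ... | no ¬Pu =
      suc u , ≤′⇒≤ (≤′-step q≤′u) , ≤-refl ,
      (λ a q≤a a<1+u → ¬Pu ∘ P-upward-closed q≤a (≤-trans (≤-pred a<1+u) u≤toℕu)) ,
      (λ _ 1+u≤a a<1+u → ⊥-elim (<⇒≱ a<1+u 1+u≤a))
      where
      u≤toℕu : u ≤ toℕ (fromℕ< u<n)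
      u≤toℕu = ≤-reflexive (sym (Fin.toℕ-fromℕ< u<n))

module _ {n} {w : Word n} (w-injective : Injective _≡_ _≡_ w)
         (avoids-3124 : Avoids p3124 w) (avoids-3214 : Avoids p3214 w) where

  >-of-≮ : ∀ {p q} → p ≢ q → ¬ (w p < w q) → w q < w p
  >-of-≮ p≢q wp≮wq = ≤∧≢⇒< (≮⇒≥ wp≮wq) (λ eq → p≢q (w-injective (sym eq)))

  no-two-smaller-between-larger : ∀ {a b c e} → a F.< b → b F.< c → c F.< e →
    w b < w a → w c < w a → w a < w e → ⊥
  no-two-smaller-between-larger {a} {b} {c} {e} a<b b<c c<e wb<wa wc<wa wa<we
    with <-cmp (w b) (w c)
  ... | tri< wb<wc _ _ = avoids-3124 (contains-at p3124 w p3124-injective a<b b<c c<e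
          (p3124-order (w ∘ lookup (a ∷ b ∷ c ∷ e ∷ [])) wb<wc wc<wa wa<we))
  ... | tri≈ _ wb≡wc _ = Fin.<⇒≢ b<c (w-injective wb≡wc)
  ... | tri> _ _ wc<wb = avoids-3214 (contains-at p3214 w p3214-injective a<b b<c c<e
          (p3214-order (w ∘ lookup (a ∷ b ∷ c ∷ e ∷ [])) wc<wb wb<wa wa<we))

  module _ (x : Fin n) (x-max : ∀ j → w j ≤ w x) where

    below-max : ∀ {p} → p ≢ x → w p < w x
    below-max p≢x = ≤∧≢⇒< (x-max _) (p≢x ∘ w-injective)

    not-max : ∀ {p q} → w q < w p → q ≢ x
    not-max {p} wq<wp refl = <⇒≱ wq<wp (x-max p)

    descent-tops-increasing : ∀ {i i'} → i F.< i' → i' F.< x →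
      DescentAt w i → DescentAt w i' → w i < w i'
    descent-tops-increasing {i} {i'} i<i' i'<x (j , j≡1+i , wj<wi) (j' , j'≡1+i' , wj'<wi')
      with w i <? w i'
    ... | yes wi<wi' = wi<wi'
    ... | no wi≮wi' = ⊥-elim (no-two-smaller-between-larger i<j j<j' j'<x
                        wj<wi (<-trans wj'<wi' wi'<wi) (below-max (Fin.<⇒≢ (<-trans i<i' i'<x))))
      where
      wi'<wi : w i' < w i
      wi'<wi = >-of-≮ (Fin.<⇒≢ i<i') wi≮wi'
      i<j : i F.< j
      i<j = ≤-reflexive (sym j≡1+i)
      j<j' : j F.< j'
      j<j' = ≤-<-trans (≤-trans (≤-reflexive j≡1+i) i<i') (≤-reflexive (sym j'≡1+i'))
      j'<x : j' F.< x
      j'<x = Fin.≤∧≢⇒< (≤-trans (≤-reflexive j'≡1+i') i'<x) (not-max wj'<wi')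

    descent-bound-persists : ∀ {i a b} → i F.< x → DescentAt w i → x F.< a → a F.≤ b →
      w a < w i → w b < w i
    descent-bound-persists {i} {a} {b} i<x (j , j≡1+i , wj<wi) x<a a≤b wa<wi with w b <? w i
    ... | yes wb<wi = wb<wi
    ... | no wb≮wi = ⊥-elim (no-two-smaller-between-larger i<j j<a a<b wj<wi wa<wi wi<wb)
      where
      wi<wb : w i < w b
      wi<wb = >-of-≮ (Fin.<⇒≢ (<-trans i<x (<-≤-trans x<a a≤b)) ∘ sym) wb≮wi
      i<j : i F.< j
      i<j = ≤-reflexive (sym j≡1+i)
      j<a : j F.< a
      j<a = ≤-<-trans (≤-trans (≤-reflexive j≡1+i) i<x) x<a
      a<b : a F.< b
      a<b = Fin.≤∧≢⇒< a≤b λ { refl → wb≮wi wa<wi }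

    lrmax-≤-max : ∀ {i} → LrmaxAt w i → i F.≤ x
    lrmax-≤-max {i} i-lrmax = ≮⇒≥ λ x<i → <⇒≱ (i-lrmax x x<i) (x-max i)

    lrmax-of-ascent : ∀ {j} → j F.≤ x → (∀ c → toℕ j ≡ suc (toℕ c) → w c < w j) → LrmaxAt w j
    lrmax-of-ascent {j} j≤x ascent a a<j with w a <? w j
    ... | yes wa<wj = wa<wj
    ... | no wa≮wj with predecessor j (≤-trans (s≤s z≤n) a<j)
    ...   | c , j≡1+c = ⊥-elim (no-two-smaller-between-larger a<c c<j j<x
                          (<-trans wc<wj wj<wa) wj<wa (below-max (Fin.<⇒≢ (<-≤-trans a<j j≤x))))
      where
      wj<wa : w j < w a
      wj<wa = >-of-≮ (Fin.<⇒≢ a<j) wa≮wj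
      wc<wj : w c < w j
      wc<wj = ascent c j≡1+c
      c<j : c F.< j
      c<j = ≤-reflexive (sym j≡1+c)
      a<c : a F.< c
      a<c = Fin.≤∧≢⇒< (≤-pred (≤-trans a<j (≤-reflexive j≡1+c))) λ { refl → <-asym wc<wj wj<wa }
      j<x : j F.< x
      j<x = Fin.≤∧≢⇒< j≤x (not-max wj<wa)

    module DescentsBeforeMax {k} (d : Fin k → Fin n)
      (d-increasing : ∀ a b → a F.< b → d a F.< d b)
      (d-enumerates : ∀ i → ((i F.< x) × DescentAt w i) ⇔ (∃ λ m → d m ≡ i)) where

      d<x : ∀ m → d m F.< x
      d<x m = proj₁ (Equivalence.from (d-enumerates (d m)) (m , refl))

      d-descent : ∀ m → DescentAt w (d m)
      d-descent m = proj₂ (Equivalence.from (d-enumerates (d m)) (m , refl))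

      d-tops-monotone : ∀ {m m'} → m F.≤ m' → w (d m) ≤ w (d m')
      d-tops-monotone {m} {m'} m≤m' with Fin.<-cmp m m'
      ... | tri< m<m' _ _ = <⇒≤ (descent-tops-increasing (d-increasing m m' m<m') (d<x m')
                                  (d-descent m) (d-descent m'))
      ... | tri≈ _ refl _ = ≤-refl
      ... | tri> _ _ m'<m = ⊥-elim (<⇒≱ m'<m m≤m')

      ascent-unless-after-d : ∀ {j} → j F.≤ x → (∀ m → toℕ j ≢ suc (toℕ (d m))) →
        ∀ c → toℕ j ≡ suc (toℕ c) → w c < w j
      ascent-unless-after-d {j} j≤x not-after c j≡1+c with w c <? w j
      ... | yes wc<wj = wc<wj
      ... | no wc≮wj =
        let m , dm≡c = Equivalence.to (d-enumerates c)
                         (<-≤-trans c<j j≤x , j , j≡1+c , >-of-≮ (Fin.<⇒≢ c<j) wc≮wj)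
        in ⊥-elim (not-after m (subst (λ i → toℕ j ≡ suc (toℕ i)) (sym dm≡c) j≡1+c))
        where
        c<j : c F.< j
        c<j = ≤-reflexive (sym j≡1+c)

      lrmax-iff : ∀ v → InLrmax w v ⇔
        (Σ (Fin n) λ j → (j F.≤ x) × (∀ m → toℕ j ≢ suc (toℕ (d m))) × (w j ≡ v))
      lrmax-iff v = mk⇔
        (λ (i , wi≡v , i-lrmax) →
           i , lrmax-≤-max i-lrmax ,
           (λ m i≡1+dm → lrmax-not-after-descent i-lrmax i≡1+dm (d-descent m)) , wi≡v)
        (λ (j , j≤x , not-after , wj≡v) →
           j , wj≡v , lrmax-of-ascent j≤x (ascent-unless-after-d j≤x not-after))

      tail-split : ∀ m → Threshold (λ p → w p < w (d m)) (suc (toℕ x))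
      tail-split m = threshold (λ p → w p <? w (d m))
                       (descent-bound-persists (d<x m) (d-descent m)) (Fin.toℕ<n x)

      t : Fin k → ℕ
      t m = Threshold.point (tail-split m)

      x<t : ∀ m → suc (toℕ x) ≤ t m
      x<t m = Threshold.q≤point (tail-split m)

      t≤n : ∀ m → t m ≤ n
      t≤n m = Threshold.point≤n (tail-split m)

      below-from-t : ∀ m p → t m ≤ toℕ p → w p < w (d m)
      below-from-t m = Threshold.holds-from (tail-split m)

      above-before-t : ∀ m p → x F.< p → toℕ p < t m → w (d m) < w p
      above-before-t m p x<p p<t =
        >-of-≮ (Fin.<⇒≢ (<-trans (d<x m) x<p) ∘ sym) (Threshold.fails-before (tail-split m) p x<p p<t)

      t-antitone : ∀ {m m'} → m F.≤ m' → t m' ≤ t m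
      t-antitone {m} {m'} m≤m' = ≮⇒≥ no-position-between
        where
        no-position-between : ¬ (t m < t m')
        no-position-between tm<tm' =
          <-asym (above-before-t m' p (≤-trans (x<t m) (≤-reflexive (sym p≡tm)))
                                      (≤-trans (s≤s (≤-reflexive p≡tm)) tm<tm'))
                 (<-≤-trans (below-from-t m p (≤-reflexive (sym p≡tm))) (d-tops-monotone m≤m'))
          where
          tm<n : t m < n
          tm<n = <-≤-trans tm<tm' (t≤n m')
          p : Fin n
          p = fromℕ< tm<n
          p≡tm : toℕ p ≡ t m
          p≡tm = Fin.toℕ-fromℕ< tm<n

-- The positivity of the entries plays no role.
proposition2p2 : ∀ (n : ℕ) (w : Word n) →
    Injective _≡_ _≡_ w →
    (∀ i → 0 < w i) →
    Avoids p3124 w →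
    Avoids p3214 w →
    ∀ (x : Fin n) → (∀ j → w j ≤ w x) →
    ∀ (k : ℕ) (d : Fin k → Fin n) →
    (∀ a b → a F.< b → d a F.< d b) →
    (∀ i → ((i F.< x) × DescentAt w i) ⇔ (∃ λ m → d m ≡ i)) →
    ((∀ v → InLrmax w v ⇔
        (Σ (Fin n) λ j → (j F.≤ x) × (∀ m → toℕ j ≢ suc (toℕ (d m))) × (w j ≡ v)))
    ×
     (Σ (Fin k → ℕ) λ t →
        (∀ m → suc (toℕ x) ≤ t m) × (∀ m → t m ≤ n) ×
        (∀ m m' → m F.≤ m' → t m' ≤ t m) ×
        (∀ (p : Fin n) → x F.< p → (∀ m → toℕ p < t m) →
           ∀ m → suc (toℕ m) ≡ k → w (d m) < w p) ×
        (∀ m m' → toℕ m ≡ suc (toℕ m') → ∀ (p : Fin n) →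
           t m ≤ toℕ p → toℕ p < t m' → (w (d m') < w p) × (w p < w (d m))) ×
        (∀ m → toℕ m ≡ 0 → ∀ (p : Fin n) → t m ≤ toℕ p → w p < w (d m))))
proposition2p2 n w w-injective _ avoids-3124 avoids-3214 x x-max k d d-increasing d-enumerates =
  lrmax-iff ,
  t , x<t , t≤n , (λ _ _ → t-antitone) ,
  (λ p x<p before-every-t m _ → above-before-t m p x<p (before-every-t m)) ,
  (λ m m' _ p tm≤p p<tm' → above-before-t m' p (≤-trans (x<t m) tm≤p) p<tm' , below-from-t m p tm≤p) ,
  (λ m _ → below-from-t m)
  where
  open DescentsBeforeMax w-injective avoids-3124 avoids-3214 x x-max d d-increasing d-enumerates
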